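{- Let $n\ge 5$ and let $\mathcal{M}$ be the discrete vector field on the matching complex $M_n$ constructed as described in the context. Then $\mathcal{M}$ is a gradient vector field on $M_n$.
   Context: The matching complex $M_n$ is the simplicial complex whose simplices are the matchings of the complete graph $K_n$ (sets of pairwise vertex-disjoint edges), including the empty matching. A discrete vector field on a complex is a set of pairs $(\alpha,\beta)$ of simplices with $\alpha\subsetneq\beta$, $\dim\beta=\dim\alpha+1$, each simplex (including $\emptyset$) in at most one pair; a gradient vector field is one with no nontrivial closed paths, where a path is $\alpha_0,\beta_0,\alpha_1,\dots,\alpha_k,\beta_k,\alpha_{k+1}$ with $(\alpha_i,\beta_i)$ in the field, $\beta_i\supsetneq\alpha_{i+1}\ne\alpha_i$, and it is nontrivial closed if $k\ge0$ and $\alpha_{k+1}=\alpha_0$. Construction of $\mathcal{M}$: write $n=3m$, $3m+1$ or $3m+2$. Partition $V(K_n)$ into $V_i=\{v^{(i)}_1,v^{(i)}_2,v^{(i)}_3\}$ for $i\in\{1,\dots,m\}$, plus $V_{m+1}=\{v^{(m+1)}_1\}$ if $n=3m+1$, or $V_{m+1}=\{v^{(m+1)}_1,v^{(m+1)}_2\}$ if $n=3m+2$. Set $\mathscr{U}_0=M_n$. For $k=1,\dots,m$ define $\mathcal{M}'_k$ as the set of pairs $(\alpha,\alpha\sqcup\{v^{(k)}_jv^{(k)}_l\})$ where $\alpha\in\mathscr{U}_{k-1}$, $\alpha$ covers exactly one vertex $v^{(k)}_i$ of $V_k$, and $\{i,j,l\}=\{1,2,3\}$; define $\mathcal{M}''_k$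 as the set of pairs $(\alpha,\alpha\sqcup\{v^{(k)}_2v^{(k)}_3\})$ where $\alpha\in\mathscr{U}_{k-1}$ covers no vertex of $V_k$; let $\mathcal{M}_k=\mathcal{M}'_k\sqcup\mathcal{M}''_k$ and let $\mathscr{U}_k$ be the set of matchings appearing in no pair of $\mathcal{M}_1\sqcup\cdots\sqcup\mathcal{M}_k$. If $n=3m+2$, additionally let $\mathcal{M}_{m+1}$ be the set of pairs $(\alpha,\alpha\sqcup\{v^{(m+1)}_1v^{(m+1)}_2\})$ with $\alpha\in\mathscr{U}_m$ covering neither $v^{(m+1)}_1$ nor $v^{(m+1)}_2$. Then $\mathcal{M}=\mathcal{M}_1\sqcup\cdots\sqcup\mathcal{M}_m$ if $n\in\{3m,3m+1\}$, and $\mathcal{M}=\mathcal{M}_1\sqcup\cdots\sqcup\mathcal{M}_{m+1}$ if $n=3m+2$. -}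

module Defs where

open import Data.Nat using (ℕ; zero; suc; _+_; _*_; _/_)
open import Data.Fin using (Fin; zero; suc; combine; _↑ˡ_; _↑ʳ_)
open import Data.Fin.Permutation using (Permutation′; _⟨$⟩ʳ_)
open import Data.Maybe using (Maybe; just; nothing)
open import Data.Vec using (Vec; lookup; _[_]≔_; count)
open import Data.Maybe using (is-just)
open import Data.Bool using (T)
open import Data.Product using (Σ; ∃; _×_; _,_)
open import Data.Sum using (_⊎_)
open import Data.Empty using (⊥)
open import Relation.Nullary using (¬_)
open import Relation.Binary.PropositionalEquality using (_≡_; _≢_)

-- A (raw) configuration assigns to each vertex its partner (if any).
-- A matching of K_n is a configuration that is a fixed-point-free partial
-- involution; this is a canonical encoding of a set of pairwise
-- vertex-disjoint edges (so propositional equality = equality of edge sets).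

Mat : ℕ → Set
Mat n = Vec (Maybe (Fin n)) n

module _ {n : ℕ} where

  -- α is a matching of K_n, i.e. a simplex of M_n (the empty matching included)
  IsMatching : Mat n → Set
  IsMatching α = ∀ v w → lookup α v ≡ just w → (w ≢ v) × (lookup α w ≡ just v)

  _⊆_ : Mat n → Mat n → Set
  α ⊆ β = ∀ v w → lookup α v ≡ just w → lookup β v ≡ just w

  _⊊_ : Mat n → Mat n → Set
  α ⊊ β = (α ⊆ β) × (α ≢ β)

  -- number of covered vertices, and number of edges (dimension = edges - 1)
  coveredCount : Mat n → ℕ
  coveredCount α = count (λ x → Data.Bool._≟_ (is-just x) Data.Bool.true) α
    where import Data.Bool

  numEdges : Mat n → ℕ
  numEdges α = coveredCount α / 2

  DimSucc : Mat n → Mat n → Set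
  DimSucc α β = numEdges β ≡ suc (numEdges α)

  Covers : Mat n → Fin n → Set
  Covers α v = ∃ λ w → lookup α v ≡ just w

  addEdge : Mat n → Fin n → Fin n → Mat n
  addEdge α a b = (α [ a ]≔ just b) [ b ]≔ just a

-- Discrete vector fields and gradient vector fields on M_n.
-- A vector field is given as a relation on configurations: P α β means
-- (α , β) belongs to the field.

module _ {n : ℕ} (P : Mat n → Mat n → Set) where

  IsDiscreteVectorField : Set
  IsDiscreteVectorField =
    (∀ α β → P α β →
        IsMatching α × IsMatching β × (α ⊊ β) × DimSucc α β)
    × (∀ α β α′ β′ → P α β → P α′ β′ →
        ((α ≡ α′) ⊎ (α ≡ β′) ⊎ (β ≡ α′) ⊎ (β ≡ β′)) →
        (α ≡ α′) × (β ≡ β′))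

  -- A nontrivial closed path α₀,β₀,α₁,…,α_k,β_k,α_{k+1}=α₀ (k ≥ 0)
  NontrivialClosedPath : Set
  NontrivialClosedPath =
    Σ ℕ λ k → Σ (ℕ → Mat n) λ a → Σ (ℕ → Mat n) λ b →
      (∀ i → i Data.Nat.≤ k →
          P (a i) (b i) × (a (suc i) ⊊ b i) × (a (suc i) ≢ a i))
      × (a (suc k) ≡ a zero)
    where import Data.Nat

  IsGradientVectorField : Set
  IsGradientVectorField = IsDiscreteVectorField × ¬ NontrivialClosedPath

-- The construction of 𝓜, for n = m * 3 + r (r ∈ {0,1,2}).
-- σ is an arbitrary labelling of the vertices; the parts are
-- V_k = {σ(3k), σ(3k+1), σ(3k+2)} (k = 0,…,m-1, i.e. the paper's V_{k+1})
-- and V_{m+1} = {σ(3m), …, σ(3m+r-1)}.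

module Construction (m r : ℕ) (σ : Permutation′ (m * 3 + r)) where

  N : ℕ
  N = m * 3 + r

  -- v^{(b+1)}_{j+1}
  vtx : Fin m → Fin 3 → Fin N
  vtx b j = σ ⟨$⟩ʳ (combine b j ↑ˡ r)

  others : Fin 3 → Fin 3 × Fin 3
  others zero = suc zero , suc (suc zero)
  others (suc zero) = zero , suc (suc zero)
  others (suc (suc zero)) = zero , suc zero

  fst : Fin 3 × Fin 3 → Fin 3
  fst (x , _) = x
  snd : Fin 3 × Fin 3 → Fin 3
  snd (_ , y) = y

  CoversExactly : Mat N → Fin m → Fin 3 → Set
  CoversExactly α b i = Covers α (vtx b i) × (∀ j → j ≢ i → ¬ Covers α (vtx b j))

  CoversNone : Mat N → Fin m → Set
  CoversNone α b = ∀ j → ¬ Covers α (vtx b j)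

  -- the defining condition of M'_b ⊔ M''_b (without the condition α ∈ U)
  BlockRule : Fin m → Mat N → Mat N → Set
  BlockRule b α β =
    (Σ (Fin 3) λ i → CoversExactly α b i ×
        (β ≡ addEdge α (vtx b (fst (others i))) (vtx b (snd (others i)))))
    ⊎ (CoversNone α b × (β ≡ addEdge α (vtx b (suc zero)) (vtx b (suc (suc zero)))))

  extraEdge : (s : ℕ) → Maybe (Fin (m * 3 + s) × Fin (m * 3 + s))
  extraEdge 2 = just ((m * 3) ↑ʳ zero , (m * 3) ↑ʳ suc zero)
  extraEdge _ = nothing

  ExtraRule′ : Maybe (Fin N × Fin N) → Mat N → Mat N → Set
  ExtraRule′ nothing α β = ⊥
  ExtraRule′ (just (a , b)) α β =
    ¬ Covers α (σ ⟨$⟩ʳ a) × ¬ Covers α (σ ⟨$⟩ʳ b) ×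
    (β ≡ addEdge α (σ ⟨$⟩ʳ a) (σ ⟨$⟩ʳ b))

  ExtraRule : Mat N → Mat N → Set
  ExtraRule = ExtraRule′ (extraEdge r)

  -- stage k (0-based): block k if k < m, else the extra stage if k = m
  blockAt : (p k : ℕ) → Maybe (Fin p)
  blockAt zero _ = nothing
  blockAt (suc p) zero = just zero
  blockAt (suc p) (suc k) = Data.Maybe.map suc (blockAt p k)
    where import Data.Maybe

  Rule′ : ℕ → Maybe (Fin m) → Mat N → Mat N → Set
  Rule′ k (just b) = BlockRule b
  Rule′ k nothing α β = (k ≡ m) × ExtraRule α β

  Rule : ℕ → Mat N → Mat N → Set
  Rule k = Rule′ k (blockAt m k)

  mutual
    U : ℕ → Mat N → Set
    U zero α = IsMatching α
    U (suc k) α = U k α × ¬ (∃ λ β → Stage k α β) × ¬ (∃ λ γ → Stage k γ α)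

    -- Stage k = 𝓜_{k+1}
    Stage : ℕ → Mat N → Mat N → Set
    Stage k α β = U k α × Rule k α β

  𝓜 : Mat N → Mat N → Set
  𝓜 α β = ∃ λ k → Stage k α β

-- Every pair of 𝓜 adds a single edge to a matching, and the matchings surviving the first k stages
-- (𝒰_k) are exactly those that are critical on V_1, …, V_k: on each of these blocks they neither cover
-- at most one vertex (the shape of a source of the block rule) nor contain a block edge in the shape of
-- its target.  Hence each stage pairs matchings of 𝒰_{k-1} injectively and 𝓜 is a discrete vector field.
--
-- For acyclicity, score each block by weighing its vertices 0 if uncovered, 1 if matched inside the
-- block and 3 if matched outside, and append the number of covered vertices of V_{m+1}.  Along a path
-- α → β ⊋ α′ these scores drop lexicographically.  On the first block where α′ and α differ, either the
-- edge added by the pair lies elsewhere, so α′ lost edges there, or it is the block of the pair; then α′,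
-- being critical on all earlier blocks and the source of a pair, is no block target, so it can keep the
-- new edge only by giving up the outside partner of the opposite vertex, trading weight 3 for 1 + 1.
-- If α′ agrees with α on all blocks it is critical everywhere, so its own pair adds the edge of V_{m+1},
-- which it therefore lacks: it lost an edge at V_{m+1}.

module Submission where

open import Defs
open import Data.Nat using (ℕ; zero; suc; _+_; _*_; _≤_; _<_; z≤n; s≤s; _/_)
open import Data.Nat.Properties
  using (≤-refl; <-irrefl; <-trans; <-resp₂-≡; +-mono-≤; +-mono-<-≤; +-mono-≤-<; m≤m+n; <-≤-trans;
         <⇒≤; m≤n⇒m≤1+n; ≤-pred; m≤n⇒m<n∨m≡n; <-cmp)
open import Data.Fin as Fin using (Fin; zero; suc; toℕ; combine; _↑ˡ_; _↑ʳ_; splitAt; remQuot; join)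
open import Data.Fin.Properties
  using (¬∀⟶∃¬; any?; all?; toℕ<n; toℕ-injective; toℕ-↑ˡ; toℕ-↑ʳ; ↑ˡ-injective; ↑ʳ-injective; combine-injective;
         join-splitAt; combine-remQuot)
open import Data.Fin.Permutation using (Permutation′; _⟨$⟩ʳ_; _⟨$⟩ˡ_; inverseˡ; inverseʳ)
open import Data.Maybe using (Maybe; just; nothing; maybe′; is-just)
import Data.Maybe.Properties as Maybe
open import Data.Vec using (Vec; _∷_; lookup; tabulate; sum; _[_]≔_; count)
open import Data.Vec.Properties using (lookup∘update; lookup∘update′; tabulate-cong)
open import Data.Nat.DivMod using (m/n≡1+[m∸n]/n)
open import Data.Bool using (true; false; if_then_else_)
import Data.Bool as Bool
open import Data.Vec.Relation.Binary.Pointwise.Extensional using (ext; Pointwise-≡⇒≡)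
import Data.Vec.Relation.Binary.Pointwise.Inductive as Pointwise
open import Data.Vec.Relation.Binary.Lex.Strict as VecLex using (Lex-<; this; next)
open import Data.Product using (Σ; ∃; _×_; _,_; proj₁; proj₂)
open import Data.Product.Relation.Binary.Lex.Strict using (×-Lex; ×-transitive; ×-irreflexive)
open import Data.Sum using (_⊎_; inj₁; inj₂; [_,_]′)
open import Data.Empty using (⊥; ⊥-elim)
open import Function using (_∘_)
open import Level using (0ℓ)
open import Relation.Binary using (Rel; Transitive; DecidableEquality; IsEquivalence; tri<; tri≈; tri>)
open import Relation.Nullary using (¬_; yes; no; does)
open import Relation.Nullary.Decidable using (dec-true; dec-false)
open import Relation.Binary.PropositionalEquality

-- Weighted sums and lexicographic orders

infix 4 _⊑_

_⊑_ : ∀ {A : Set} → Maybe A → Maybe A → Set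
p ⊑ q = ∀ x → p ≡ just x → q ≡ just x

sum-mono-≤ : ∀ {n} (f g : Fin n → ℕ) → (∀ i → f i ≤ g i) → sum (tabulate f) ≤ sum (tabulate g)
sum-mono-≤ {zero} f g f≤g = z≤n
sum-mono-≤ {suc n} f g f≤g = +-mono-≤ (f≤g zero) (sum-mono-≤ (f ∘ suc) (g ∘ suc) (f≤g ∘ suc))

sum-mono-< : ∀ {n} (f g : Fin n → ℕ) → (∀ i → f i ≤ g i) → ∀ i → f i < g i →
             sum (tabulate f) < sum (tabulate g)
sum-mono-< f g f≤g zero f<g = +-mono-<-≤ f<g (sum-mono-≤ (f ∘ suc) (g ∘ suc) (f≤g ∘ suc))
sum-mono-< f g f≤g (suc i) f<g = +-mono-≤-< (f≤g zero) (sum-mono-< (f ∘ suc) (g ∘ suc) (f≤g ∘ suc) i f<g)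

module _ {A : Set} (w : A → ℕ) where

  weigh : Maybe A → ℕ
  weigh = maybe′ w 0

  weightedSum : ∀ {n} → (Fin n → Maybe A) → ℕ
  weightedSum p = sum (tabulate (weigh ∘ p))

  weigh-mono : ∀ {p q} → p ⊑ q → weigh p ≤ weigh q
  weigh-mono {nothing} _ = z≤n
  weigh-mono {just x} p⊑q rewrite p⊑q x refl = ≤-refl

  module _ (pos : ∀ x → 0 < w x) where

    weigh-mono-< : ∀ {p q} → p ⊑ q → p ≢ q → weigh p < weigh q
    weigh-mono-< {nothing} {nothing} _ p≢q = ⊥-elim (p≢q refl)
    weigh-mono-< {nothing} {just y} _ _ = pos y
    weigh-mono-< {just x} p⊑q p≢q = ⊥-elim (p≢q (sym (p⊑q x refl)))

    weightedSum-mono-< : DecidableEquality A → ∀ {n} (p q : Fin n → Maybe A) →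
                         (∀ i → p i ⊑ q i) → ¬ (∀ i → p i ≡ q i) → weightedSum p < weightedSum q
    weightedSum-mono-< _≟_ {n} p q p⊑q p≢q with ¬∀⟶∃¬ n _ (λ i → Maybe.≡-dec _≟_ (p i) (q i)) p≢q
    ... | i , pᵢ≢qᵢ = sum-mono-< _ _ (λ j → weigh-mono (p⊑q j)) i (weigh-mono-< (p⊑q i) pᵢ≢qᵢ)

module _ {p : ℕ} where

  _<ₗₑₓ_ : Rel (Vec ℕ p) 0ℓ
  _<ₗₑₓ_ = Lex-< _≡_ _<_

  _<ₗₑₓ×_ : Rel (Vec ℕ p × ℕ) 0ℓ
  _<ₗₑₓ×_ = ×-Lex _≡_ _<ₗₑₓ_ _<_

  <ₗₑₓ×-trans : Transitive _<ₗₑₓ×_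
  <ₗₑₓ×-trans = ×-transitive {_≈₁_ = _≡_} {_<₁_ = _<ₗₑₓ_} {_<₂_ = _<_} isEquivalence (resp₂ _<ₗₑₓ_)
    (VecLex.<-trans (IsEquivalence.isPartialEquivalence isEquivalence) <-resp₂-≡ <-trans) <-trans

  <ₗₑₓ×-irrefl : ∀ {x} → ¬ x <ₗₑₓ× x
  <ₗₑₓ×-irrefl = ×-irreflexive {_≈₁_ = _≡_} {_<₁_ = _<ₗₑₓ_} {_≈₂_ = _≡_} {_<₂_ = _<_}
    (λ { refl → VecLex.<-irrefl <-irrefl (Pointwise.refl refl) }) <-irrefl (refl , refl)

pointwise-or-lex : ∀ {p} (E : Fin p → Set) (f g : Fin p → ℕ) → (∀ i → E i → f i ≡ g i) →
                   (∀ i → (∀ j → j Fin.< i → E j) → E i ⊎ f i < g i) →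
                   (∀ i → E i) ⊎ tabulate f <ₗₑₓ tabulate g
pointwise-or-lex {zero} E f g E⇒≡ step = inj₁ λ ()
pointwise-or-lex {suc p} E f g E⇒≡ step with step zero (λ _ ())
... | inj₂ f₀<g₀ = inj₂ (this f₀<g₀ refl)
... | inj₁ E₀ with pointwise-or-lex (E ∘ suc) (f ∘ suc) (g ∘ suc) (E⇒≡ ∘ suc)
                     (λ i earlier → step (suc i) λ { zero _ → E₀ ; (suc j) (s≤s j<i) → earlier j j<i })
...   | inj₂ tail< = inj₂ (next (E⇒≡ zero E₀) tail<)
...   | inj₁ Eₛ = inj₁ λ { zero → E₀ ; (suc i) → Eₛ i }

-- Adding and deleting an edge

lookup-ext : ∀ {A : Set} {n} {xs ys : Vec A n} → (∀ i → lookup xs i ≡ lookup ys i) → xs ≡ ys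
lookup-ext h = Pointwise-≡⇒≡ (ext h)

count-update-just : ∀ {A : Set} {k} (xs : Vec (Maybe A) k) i x → lookup xs i ≡ nothing →
                    count (λ y → is-just y Bool.≟ true) (xs [ i ]≔ just x)
                      ≡ suc (count (λ y → is-just y Bool.≟ true) xs)
count-update-just (nothing ∷ xs) zero x _ = refl
count-update-just (nothing ∷ xs) (suc i) x xsᵢ≡nothing = count-update-just xs i x xsᵢ≡nothing
count-update-just (just _ ∷ xs) (suc i) x xsᵢ≡nothing = cong suc (count-update-just xs i x xsᵢ≡nothing)

module _ {n : ℕ} where

  deleteEdge : Mat n → Fin n → Fin n → Mat n
  deleteEdge α x y = (α [ x ]≔ nothing) [ y ]≔ nothing

  ¬Covers⇒≡nothing : ∀ (α : Mat n) {v} → ¬ Covers α v → lookup α v ≡ nothing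
  ¬Covers⇒≡nothing α {v} ¬cov with lookup α v
  ... | nothing = refl
  ... | just w = ⊥-elim (¬cov (w , refl))

  Covers-resp : ∀ {α α′ : Mat n} {v} → lookup α v ≡ lookup α′ v → Covers α v → Covers α′ v
  Covers-resp αᵥ≡α′ᵥ (w , αᵥ≡w) = w , trans (sym αᵥ≡α′ᵥ) αᵥ≡w

  ≡nothing⇒¬Covers : ∀ (α : Mat n) {v} → lookup α v ≡ nothing → ¬ Covers α v
  ≡nothing⇒¬Covers _ αᵥ≡nothing (w , αᵥ≡w) with () ← trans (sym αᵥ≡nothing) αᵥ≡w

  module _ (α : Mat n) (x y : Fin n) where

    addEdge-lookupʳ : lookup (addEdge α x y) y ≡ just x
    addEdge-lookupʳ = lookup∘update y (α [ x ]≔ just y) (just x)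

    addEdge-lookupˡ : x ≢ y → lookup (addEdge α x y) x ≡ just y
    addEdge-lookupˡ x≢y = trans (lookup∘update′ x≢y (α [ x ]≔ just y) (just x)) (lookup∘update x α (just y))

    addEdge-lookup-other : ∀ {v} → v ≢ x → v ≢ y → lookup (addEdge α x y) v ≡ lookup α v
    addEdge-lookup-other v≢x v≢y =
      trans (lookup∘update′ v≢y (α [ x ]≔ just y) (just x)) (lookup∘update′ v≢x α (just y))

    deleteEdge-lookupʳ : lookup (deleteEdge α x y) y ≡ nothing
    deleteEdge-lookupʳ = lookup∘update y (α [ x ]≔ nothing) nothing

    deleteEdge-lookupˡ : lookup (deleteEdge α x y) x ≡ nothing
    deleteEdge-lookupˡ with x Fin.≟ y
    ... | yes refl = deleteEdge-lookupʳ
    ... | no x≢y = trans (lookup∘update′ x≢y (α [ x ]≔ nothing) nothing) (lookup∘update x α nothing)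

    deleteEdge-lookup-other : ∀ {v} → v ≢ x → v ≢ y → lookup (deleteEdge α x y) v ≡ lookup α v
    deleteEdge-lookup-other v≢x v≢y =
      trans (lookup∘update′ v≢y (α [ x ]≔ nothing) nothing) (lookup∘update′ v≢x α nothing)

  deleteEdge-addEdge : ∀ (α : Mat n) x y → x ≢ y → lookup α x ≡ nothing → lookup α y ≡ nothing →
                       deleteEdge (addEdge α x y) x y ≡ α
  deleteEdge-addEdge α x y x≢y αₓ≡nothing αᵧ≡nothing = lookup-ext pointwise
    where
    pointwise : ∀ v → lookup (deleteEdge (addEdge α x y) x y) v ≡ lookup α v
    pointwise v with v Fin.≟ x | v Fin.≟ y
    ... | yes refl | _ = trans (deleteEdge-lookupˡ (addEdge α x y) x y) (sym αₓ≡nothing)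
    ... | no _ | yes refl = trans (deleteEdge-lookupʳ (addEdge α x y) x y) (sym αᵧ≡nothing)
    ... | no v≢x | no v≢y =
      trans (deleteEdge-lookup-other (addEdge α x y) x y v≢x v≢y) (addEdge-lookup-other α x y v≢x v≢y)

  addEdge-deleteEdge : ∀ (α : Mat n) x y → x ≢ y → lookup α x ≡ just y → lookup α y ≡ just x →
                       addEdge (deleteEdge α x y) x y ≡ α
  addEdge-deleteEdge α x y x≢y αₓ≡y αᵧ≡x = lookup-ext pointwise
    where
    pointwise : ∀ v → lookup (addEdge (deleteEdge α x y) x y) v ≡ lookup α v
    pointwise v with v Fin.≟ x | v Fin.≟ y
    ... | yes refl | _ = trans (addEdge-lookupˡ (deleteEdge α x y) x y x≢y) (sym αₓ≡y)
    ... | no _ | yes refl = trans (addEdge-lookupʳ (deleteEdge α x y) x y) (sym αᵧ≡x)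
    ... | no v≢x | no v≢y =
      trans (addEdge-lookup-other (deleteEdge α x y) x y v≢x v≢y) (deleteEdge-lookup-other α x y v≢x v≢y)

  addEdge-isMatching : ∀ {α : Mat n} {x y} → IsMatching α → x ≢ y →
                       lookup α x ≡ nothing → lookup α y ≡ nothing → IsMatching (addEdge α x y)
  addEdge-isMatching {α} {x} {y} α-matching x≢y αₓ≡nothing αᵧ≡nothing v w β-v≡w
    with v Fin.≟ x | v Fin.≟ y
  ... | yes refl | _ with refl ← Maybe.just-injective (trans (sym (addEdge-lookupˡ α x y x≢y)) β-v≡w) =
    x≢y ∘ sym , addEdge-lookupʳ α x y
  ... | no _ | yes refl with refl ← Maybe.just-injective (trans (sym (addEdge-lookupʳ α x y)) β-v≡w) =
    x≢y , addEdge-lookupˡ α x y x≢y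
  ... | no v≢x | no v≢y with α-matching v w (trans (sym (addEdge-lookup-other α x y v≢x v≢y)) β-v≡w)
  ...   | w≢v , α-w≡v = w≢v , trans (addEdge-lookup-other α x y w≢x w≢y) α-w≡v
    where
    w≢x : w ≢ x
    w≢x refl with () ← trans (sym αₓ≡nothing) α-w≡v
    w≢y : w ≢ y
    w≢y refl with () ← trans (sym αᵧ≡nothing) α-w≡v

  deleteEdge-isMatching : ∀ {α : Mat n} {x y} → IsMatching α → lookup α x ≡ just y →
                          IsMatching (deleteEdge α x y)
  deleteEdge-isMatching {α} {x} {y} α-matching αₓ≡y v w γ-v≡w with v Fin.≟ x | v Fin.≟ y
  ... | yes refl | _ with () ← trans (sym (deleteEdge-lookupˡ α x y)) γ-v≡w
  ... | no _ | yes refl with () ← trans (sym (deleteEdge-lookupʳ α x y)) γ-v≡w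
  ... | no v≢x | no v≢y with α-matching v w (trans (sym (deleteEdge-lookup-other α x y v≢x v≢y)) γ-v≡w)
  ...   | w≢v , α-w≡v = w≢v , trans (deleteEdge-lookup-other α x y w≢x w≢y) α-w≡v
    where
    w≢x : w ≢ x
    w≢x refl = v≢y (Maybe.just-injective (trans (sym α-w≡v) αₓ≡y))
    w≢y : w ≢ y
    w≢y refl = v≢x (Maybe.just-injective (trans (sym α-w≡v) (proj₂ (α-matching x y αₓ≡y))))

  record AddsEdge (α β : Mat n) (x y : Fin n) : Set where
    field
      distinct : x ≢ y
      uncoveredˡ : lookup α x ≡ nothing
      uncoveredʳ : lookup α y ≡ nothing
      target : β ≡ addEdge α x y

  module _ {α β : Mat n} {x y : Fin n} (e : AddsEdge α β x y) where
    open AddsEdge e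

    addsEdge-lookupˡ : lookup β x ≡ just y
    addsEdge-lookupˡ = trans (cong (λ γ → lookup γ x) target) (addEdge-lookupˡ α x y distinct)

    addsEdge-lookupʳ : lookup β y ≡ just x
    addsEdge-lookupʳ = trans (cong (λ γ → lookup γ y) target) (addEdge-lookupʳ α x y)

    addsEdge-lookup-other : ∀ {v} → v ≢ x → v ≢ y → lookup β v ≡ lookup α v
    addsEdge-lookup-other {v} v≢x v≢y = trans (cong (λ γ → lookup γ v) target) (addEdge-lookup-other α x y v≢x v≢y)

    addsEdge-isMatching : IsMatching α → IsMatching β
    addsEdge-isMatching α-matching =
      subst IsMatching (sym target) (addEdge-isMatching {α} α-matching distinct uncoveredˡ uncoveredʳ)

    addsEdge-⊊ : α ⊊ β
    addsEdge-⊊ = ⊆β , α≢β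
      where
      ⊆β : α ⊆ β
      ⊆β v w αᵥ≡w = trans (addsEdge-lookup-other v≢x v≢y) αᵥ≡w
        where
        v≢x : v ≢ x
        v≢x refl with () ← trans (sym uncoveredˡ) αᵥ≡w
        v≢y : v ≢ y
        v≢y refl with () ← trans (sym uncoveredʳ) αᵥ≡w
      α≢β : α ≢ β
      α≢β refl with () ← trans (sym uncoveredˡ) addsEdge-lookupˡ

    addsEdge-dimSucc : DimSucc α β
    addsEdge-dimSucc rewrite target =
      trans (cong (_/ 2) twoMore) (m/n≡1+[m∸n]/n {2 + coveredCount α} {2} (s≤s (s≤s z≤n)))
      where
      twoMore : coveredCount (addEdge α x y) ≡ 2 + coveredCount α
      twoMore = trans (count-update-just (α [ x ]≔ just y) y x
                        (trans (lookup∘update′ (distinct ∘ sym) α (just y)) uncoveredʳ))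
                      (cong suc (count-update-just α x y uncoveredˡ))

    addsEdge-⊑ : ∀ {α′} → α′ ⊆ β → ∀ {v} → v ≢ x → v ≢ y → lookup α′ v ⊑ lookup α v
    addsEdge-⊑ α′⊆β v≢x v≢y w α′ᵥ≡w = trans (sym (addsEdge-lookup-other v≢x v≢y)) (α′⊆β _ w α′ᵥ≡w)

  addsEdge-⊆-source : ∀ {α β α′ : Mat n} {x y} → AddsEdge α β x y → α′ ⊆ β →
                      lookup α′ x ≡ nothing → lookup α′ y ≡ nothing → α′ ⊆ α
  addsEdge-⊆-source {α′ = α′} {x} {y} e α′⊆β α′ₓ≡nothing α′ᵧ≡nothing v w α′ᵥ≡w =
    addsEdge-⊑ e {α′} α′⊆β v≢x v≢y w α′ᵥ≡w
    where
    v≢x : v ≢ x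
    v≢x refl with () ← trans (sym α′ₓ≡nothing) α′ᵥ≡w
    v≢y : v ≢ y
    v≢y refl with () ← trans (sym α′ᵧ≡nothing) α′ᵥ≡w

  addsEdge-⊆-source-without-edge : ∀ {α β α′ : Mat n} {x y} → IsMatching α′ → AddsEdge α β x y → α′ ⊆ β →
                                   lookup α′ x ≢ just y → α′ ⊆ α
  addsEdge-⊆-source-without-edge {α′ = α′} {x} {y} α′-matching e α′⊆β α′ₓ≢y =
    addsEdge-⊆-source {α′ = α′} e α′⊆β α′ₓ≡nothing α′ᵧ≡nothing
    where
    α′ₓ≡nothing : lookup α′ x ≡ nothing
    α′ₓ≡nothing with lookup α′ x in α′ₓ
    ... | nothing = refl
    ... | just w = ⊥-elim (α′ₓ≢y (trans (sym (α′⊆β x w α′ₓ)) (addsEdge-lookupˡ e)))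
    α′ᵧ≡nothing : lookup α′ y ≡ nothing
    α′ᵧ≡nothing with lookup α′ y in α′ᵧ
    ... | nothing = refl
    ... | just w with refl ← Maybe.just-injective (trans (sym (α′⊆β y w α′ᵧ)) (addsEdge-lookupʳ e)) =
      ⊥-elim (α′ₓ≢y (proj₂ (α′-matching y x α′ᵧ)))

  addsEdge-source-unique : ∀ {α α′ β : Mat n} {x y} → AddsEdge α β x y → AddsEdge α′ β x y → α ≡ α′
  addsEdge-source-unique {α} {α′} {β} {x} {y} e e′ = begin
    α                                 ≡⟨ sym (deleteEdge-addEdge α x y E.distinct E.uncoveredˡ E.uncoveredʳ) ⟩
    deleteEdge (addEdge α x y) x y    ≡⟨ cong (λ γ → deleteEdge γ x y) (trans (sym E.target) E′.target) ⟩
    deleteEdge (addEdge α′ x y) x y   ≡⟨ deleteEdge-addEdge α′ x y E.distinct E′.uncoveredˡ E′.uncoveredʳ ⟩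
    α′                                ∎
    where
    open ≡-Reasoning
    module E = AddsEdge e
    module E′ = AddsEdge e′

  ⊆-¬Covers : ∀ {α β : Mat n} {v} → α ⊆ β → ¬ Covers β v → ¬ Covers α v
  ⊆-¬Covers α⊆β ¬cov (w , αᵥ≡w) = ¬cov (w , α⊆β _ w αᵥ≡w)

  Overlap : Mat n → Mat n → Mat n → Mat n → Set
  Overlap α β α′ β′ = (α ≡ α′) ⊎ (α ≡ β′) ⊎ (β ≡ α′) ⊎ (β ≡ β′)

  Overlap-sym : ∀ {α β α′ β′ : Mat n} → Overlap α β α′ β′ → Overlap α′ β′ α β
  Overlap-sym (inj₁ eq) = inj₁ (sym eq)
  Overlap-sym (inj₂ (inj₁ eq)) = inj₂ (inj₂ (inj₁ (sym eq)))
  Overlap-sym (inj₂ (inj₂ (inj₁ eq))) = inj₂ (inj₁ (sym eq))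
  Overlap-sym (inj₂ (inj₂ (inj₂ eq))) = inj₂ (inj₂ (inj₂ (sym eq)))

  addsEdge-overlap : ∀ {α β α′ β′ : Mat n} {x y} → AddsEdge α β x y → AddsEdge α′ β′ x y →
                     Overlap α β α′ β′ → α ≡ α′ × β ≡ β′
  addsEdge-overlap e e′ (inj₁ refl) = refl , trans (AddsEdge.target e) (sym (AddsEdge.target e′))
  addsEdge-overlap e e′ (inj₂ (inj₁ refl)) with () ← trans (sym (AddsEdge.uncoveredˡ e)) (addsEdge-lookupˡ e′)
  addsEdge-overlap e e′ (inj₂ (inj₂ (inj₁ refl))) with () ← trans (sym (AddsEdge.uncoveredˡ e′)) (addsEdge-lookupˡ e)
  addsEdge-overlap e e′ (inj₂ (inj₂ (inj₂ refl))) = addsEdge-source-unique e e′ , refl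

  deleteEdge-addsEdge : ∀ {α : Mat n} {x y} → IsMatching α → x ≢ y → lookup α x ≡ just y →
                        AddsEdge (deleteEdge α x y) α x y
  deleteEdge-addsEdge {α} {x} {y} α-matching x≢y αₓ≡y = record
    { distinct = x≢y
    ; uncoveredˡ = deleteEdge-lookupˡ α x y
    ; uncoveredʳ = deleteEdge-lookupʳ α x y
    ; target = sym (addEdge-deleteEdge α x y x≢y αₓ≡y (proj₂ (α-matching x y αₓ≡y)))
    }

module Gradient (m r : ℕ) (σ : Permutation′ (m * 3 + r)) where
  open Construction m r σ

  -- Vertices and blocks

  σ-injective : ∀ {a b} → σ ⟨$⟩ʳ a ≡ σ ⟨$⟩ʳ b → a ≡ b
  σ-injective {a} {b} σa≡σb = trans (sym (inverseˡ σ)) (trans (cong (σ ⟨$⟩ˡ_) σa≡σb) (inverseˡ σ))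

  vtx-injective : ∀ {b i b′ i′} → vtx b i ≡ vtx b′ i′ → b ≡ b′ × i ≡ i′
  vtx-injective {b} {i} {b′} {i′} eq =
    combine-injective b i b′ i′ (↑ˡ-injective r (combine b i) (combine b′ i′) (σ-injective eq))

  extraVtx : Fin r → Fin N
  extraVtx t = σ ⟨$⟩ʳ (m * 3 ↑ʳ t)

  extraVtx-injective : ∀ {t t′} → extraVtx t ≡ extraVtx t′ → t ≡ t′
  extraVtx-injective {t} {t′} eq = ↑ʳ-injective (m * 3) t t′ (σ-injective eq)

  vtx≢extraVtx : ∀ {b i t} → vtx b i ≢ extraVtx t
  vtx≢extraVtx {b} {i} {t} eq = <-irrefl refl (<-≤-trans m*3+t<m*3 (m≤m+n (m * 3) (toℕ t)))
    where
    m*3+t<m*3 : m * 3 + toℕ t < m * 3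
    m*3+t<m*3 = subst (_< m * 3)
      (trans (sym (toℕ-↑ˡ (combine b i) r)) (trans (cong toℕ (σ-injective eq)) (toℕ-↑ʳ (m * 3) t)))
      (toℕ<n (combine b i))

  σ-preimage : ∀ {v a} → σ ⟨$⟩ˡ v ≡ a → v ≡ σ ⟨$⟩ʳ a
  σ-preimage σ⁻¹v≡a = trans (sym (inverseʳ σ)) (cong (σ ⟨$⟩ʳ_) σ⁻¹v≡a)

  vertex-cases : ∀ v → (∃ λ b → ∃ λ i → v ≡ vtx b i) ⊎ (∃ λ t → v ≡ extraVtx t)
  vertex-cases v with splitAt (m * 3) (σ ⟨$⟩ˡ v) | join-splitAt (m * 3) r (σ ⟨$⟩ˡ v)
  ... | inj₁ a | joined = inj₁ (proj₁ (remQuot {m} 3 a) , proj₂ (remQuot {m} 3 a) ,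
                                σ-preimage (trans (sym joined) (cong (_↑ˡ r) (sym (combine-remQuot {m} 3 a)))))
  ... | inj₂ t | joined = inj₂ (t , σ-preimage (sym joined))

  others₁≢ : ∀ i → fst (others i) ≢ i
  others₁≢ zero ()
  others₁≢ (suc zero) ()
  others₁≢ (suc (suc zero)) ()

  others₂≢ : ∀ i → snd (others i) ≢ i
  others₂≢ zero ()
  others₂≢ (suc zero) ()
  others₂≢ (suc (suc zero)) ()

  others₁≢others₂ : ∀ i → fst (others i) ≢ snd (others i)
  others₁≢others₂ zero ()
  others₁≢others₂ (suc zero) ()
  others₁≢others₂ (suc (suc zero)) ()

  others-complete : ∀ i j → j ≢ i → j ≡ fst (others i) ⊎ j ≡ snd (others i)
  others-complete zero zero j≢i = ⊥-elim (j≢i refl)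
  others-complete zero (suc zero) _ = inj₁ refl
  others-complete zero (suc (suc zero)) _ = inj₂ refl
  others-complete (suc zero) zero _ = inj₁ refl
  others-complete (suc zero) (suc zero) j≢i = ⊥-elim (j≢i refl)
  others-complete (suc zero) (suc (suc zero)) _ = inj₂ refl
  others-complete (suc (suc zero)) zero _ = inj₁ refl
  others-complete (suc (suc zero)) (suc zero) _ = inj₂ refl
  others-complete (suc (suc zero)) (suc (suc zero)) j≢i = ⊥-elim (j≢i refl)

  -- The block rule adds the edge end₁ b i ─ end₂ b i opposite to v^{(b)}_i, where v^{(b)}_i is the
  -- vertex covered by the source, or i = zero when the source covers none of V_b.
  end₁ end₂ : Fin m → Fin 3 → Fin N
  end₁ b i = vtx b (fst (others i))
  end₂ b i = vtx b (snd (others i))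

  module _ {b : Fin m} where

    vtx-≢ : ∀ {i j} → i ≢ j → vtx b i ≢ vtx b j
    vtx-≢ i≢j = i≢j ∘ proj₂ ∘ vtx-injective

    end₁≢end₂ : ∀ i → end₁ b i ≢ end₂ b i
    end₁≢end₂ i = vtx-≢ (others₁≢others₂ i)

    vtx≢end₁ : ∀ i → vtx b i ≢ end₁ b i
    vtx≢end₁ i = vtx-≢ (others₁≢ i ∘ sym)

    vtx≢end₂ : ∀ i → vtx b i ≢ end₂ b i
    vtx≢end₂ i = vtx-≢ (others₂≢ i ∘ sym)

  vtx-other-block : ∀ {b b′ i i′} → b ≢ b′ → vtx b i ≢ vtx b′ i′
  vtx-other-block b≢b′ = b≢b′ ∘ proj₁ ∘ vtx-injective

  AgreeOn : Fin m → Mat N → Mat N → Set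
  AgreeOn b α α′ = ∀ i → lookup α (vtx b i) ≡ lookup α′ (vtx b i)

  data BlockSource (b : Fin m) (α : Mat N) : Set where
    none : CoversNone α b → BlockSource b α
    exactly : ∀ i → CoversExactly α b i → BlockSource b α

  data BlockTarget (b : Fin m) (α : Mat N) : Set where
    opposite : ∀ i → lookup α (end₁ b i) ≡ just (end₂ b i) → Covers α (vtx b i) → BlockTarget b α
    alone : lookup α (end₁ b zero) ≡ just (end₂ b zero) → ¬ Covers α (vtx b zero) → BlockTarget b α

  Critical : Fin m → Mat N → Set
  Critical b α = ¬ BlockSource b α × ¬ BlockTarget b α

  module _ {b : Fin m} where

    blockRule-addsEdge : ∀ {α β} → BlockRule b α β → ∃ λ i → AddsEdge α β (end₁ b i) (end₂ b i)
    blockRule-addsEdge {α} (inj₁ (i , (_ , ¬cov) , β≡)) = i , record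
      { distinct = end₁≢end₂ i
      ; uncoveredˡ = ¬Covers⇒≡nothing α (¬cov _ (others₁≢ i))
      ; uncoveredʳ = ¬Covers⇒≡nothing α (¬cov _ (others₂≢ i))
      ; target = β≡
      }
    blockRule-addsEdge {α} (inj₂ (¬cov , β≡)) = zero , record
      { distinct = end₁≢end₂ zero
      ; uncoveredˡ = ¬Covers⇒≡nothing α (¬cov _)
      ; uncoveredʳ = ¬Covers⇒≡nothing α (¬cov _)
      ; target = β≡
      }

    blockRule-source : ∀ {α β} → BlockRule b α β → BlockSource b α
    blockRule-source (inj₁ (i , cov , _)) = exactly i cov
    blockRule-source (inj₂ (¬cov , _)) = none ¬cov

    blockSource-rule : ∀ {α} → BlockSource b α → ∃ λ β → BlockRule b α β
    blockSource-rule (none ¬cov) = _ , inj₂ (¬cov , refl)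
    blockSource-rule (exactly i cov) = _ , inj₁ (i , cov , refl)

    blockRule-target : ∀ {γ α} → BlockRule b γ α → BlockTarget b α
    blockRule-target {γ} {α} (inj₁ (i , (cov , ¬cov) , β≡)) = opposite i (addsEdge-lookupˡ e)
      (Covers-resp {α = γ} {α′ = α} (sym (addsEdge-lookup-other e (vtx≢end₁ i) (vtx≢end₂ i))) cov)
      where e = proj₂ (blockRule-addsEdge (inj₁ (i , (cov , ¬cov) , β≡)))
    blockRule-target {γ} {α} (inj₂ (¬cov , β≡)) = alone (addsEdge-lookupˡ e)
      (≡nothing⇒¬Covers α (trans (addsEdge-lookup-other e (vtx≢end₁ zero) (vtx≢end₂ zero))
                                 (¬Covers⇒≡nothing γ (¬cov zero))))
      where e = proj₂ (blockRule-addsEdge (inj₂ (¬cov , β≡)))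

    addsEdge-uncovered : ∀ {γ α i} → AddsEdge γ α (end₁ b i) (end₂ b i) → ∀ j → j ≢ i → ¬ Covers γ (vtx b j)
    addsEdge-uncovered {γ} {i = i} e j j≢i with others-complete i j j≢i
    ... | inj₁ refl = ≡nothing⇒¬Covers γ (AddsEdge.uncoveredˡ e)
    ... | inj₂ refl = ≡nothing⇒¬Covers γ (AddsEdge.uncoveredʳ e)

    deleteBlockEdge : ∀ {α} i → IsMatching α → lookup α (end₁ b i) ≡ just (end₂ b i) →
                      (∀ {γ} → AddsEdge γ α (end₁ b i) (end₂ b i) → BlockRule b γ α) →
                      ∃ λ γ → IsMatching γ × (∀ b′ → b′ ≢ b → AgreeOn b′ γ α) × BlockRule b γ α
    deleteBlockEdge {α} i α-matching edge rule =
      _ , deleteEdge-isMatching {α = α} α-matching edge , agree , rule e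
      where
      e : AddsEdge (deleteEdge α (end₁ b i) (end₂ b i)) α (end₁ b i) (end₂ b i)
      e = deleteEdge-addsEdge {α = α} α-matching (end₁≢end₂ i) edge
      agree : ∀ b′ → b′ ≢ b → AgreeOn b′ (deleteEdge α (end₁ b i) (end₂ b i)) α
      agree b′ b′≢b j = sym (addsEdge-lookup-other e (vtx-other-block b′≢b) (vtx-other-block b′≢b))

    blockTarget-rule : ∀ {α} → IsMatching α → BlockTarget b α →
                       ∃ λ γ → IsMatching γ × (∀ b′ → b′ ≢ b → AgreeOn b′ γ α) × BlockRule b γ α
    blockTarget-rule {α} α-matching (opposite i edge cov) = deleteBlockEdge i α-matching edge λ {γ} e →
      inj₁ (i , (Covers-resp {α = α} {α′ = γ} (addsEdge-lookup-other e (vtx≢end₁ i) (vtx≢end₂ i)) cov ,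
                 addsEdge-uncovered e) ,
            AddsEdge.target e)
    blockTarget-rule {α} α-matching (alone edge ¬cov) = deleteBlockEdge zero α-matching edge λ {γ} e →
      inj₂ ((λ { zero → ≡nothing⇒¬Covers γ (trans (sym (addsEdge-lookup-other e (vtx≢end₁ zero) (vtx≢end₂ zero)))
                                                  (¬Covers⇒≡nothing α ¬cov))
               ; (suc j) → addsEdge-uncovered {i = zero} e (suc j) λ () }) ,
            AddsEdge.target e)

    blockSource-atMostOne : ∀ {α j j′} → BlockSource b α → Covers α (vtx b j) → Covers α (vtx b j′) → j ≡ j′
    blockSource-atMostOne (none ¬cov) cov _ = ⊥-elim (¬cov _ cov)
    blockSource-atMostOne {j = j} {j′} (exactly i (_ , ¬cov)) cov cov′ with j Fin.≟ i | j′ Fin.≟ i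
    ... | yes refl | yes refl = refl
    ... | no j≢i | _ = ⊥-elim (¬cov j j≢i cov)
    ... | _ | no j′≢i = ⊥-elim (¬cov j′ j′≢i cov′)

    blockTarget-edge : ∀ {α} → BlockTarget b α → ∃ λ i → lookup α (end₁ b i) ≡ just (end₂ b i)
    blockTarget-edge (opposite i edge _) = i , edge
    blockTarget-edge (alone edge _) = zero , edge

    blockSource-¬target : ∀ {α} → IsMatching α → BlockSource b α → ¬ BlockTarget b α
    blockSource-¬target {α} α-matching source target with blockTarget-edge target
    ... | i , edge = others₁≢others₂ i
      (blockSource-atMostOne source (_ , edge) (_ , proj₂ (α-matching _ _ edge)))

    critical-resp : ∀ {α α′} → AgreeOn b α α′ → Critical b α → Critical b α′
    critical-resp {α} {α′} agree (¬source , ¬target) = ¬source ∘ source-back , ¬target ∘ target-back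
      where
      back : ∀ {v} → Covers α′ v → lookup α v ≡ lookup α′ v → Covers α v
      back cov αᵥ≡α′ᵥ = Covers-resp {α = α′} {α′ = α} (sym αᵥ≡α′ᵥ) cov
      source-back : BlockSource b α′ → BlockSource b α
      source-back (none ¬cov) = none λ j cov → ¬cov j (Covers-resp {α = α} {α′ = α′} (agree j) cov)
      source-back (exactly i (cov , ¬cov)) =
        exactly i (back cov (agree i) , λ j j≢i cov′ → ¬cov j j≢i (Covers-resp {α = α} {α′ = α′} (agree j) cov′))
      target-back : BlockTarget b α′ → BlockTarget b α
      target-back (opposite i edge cov) = opposite i (trans (agree _) edge) (back cov (agree i))
      target-back (alone edge ¬cov) = alone (trans (agree _) edge) (¬cov ∘ Covers-resp {α = α} {α′ = α′} (agree zero))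

    blockEdge-unique : ∀ {β i i′} → IsMatching β →
                       lookup β (end₁ b i) ≡ just (end₂ b i) → lookup β (end₁ b i′) ≡ just (end₂ b i′) → i ≡ i′
    blockEdge-unique {β} {i} {i′} β-matching edge edge′ =
      compare i i′ (edge , proj₂ (β-matching _ _ edge)) (edge′ , proj₂ (β-matching _ _ edge′))
      where
      Edge : Fin 3 → Set
      Edge i = lookup β (end₁ b i) ≡ just (end₂ b i) × lookup β (end₂ b i) ≡ just (end₁ b i)
      partner-unique : ∀ {j k k′} → lookup β (vtx b j) ≡ just (vtx b k) → lookup β (vtx b j) ≡ just (vtx b k′) →
                       k ≡ k′
      partner-unique βⱼ≡k βⱼ≡k′ = proj₂ (vtx-injective (Maybe.just-injective (trans (sym βⱼ≡k) βⱼ≡k′)))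
      -- two distinct edges inside the three-vertex block share an endpoint, which would have two partners
      compare : ∀ i i′ → Edge i → Edge i′ → i ≡ i′
      compare zero zero _ _ = refl
      compare (suc zero) (suc zero) _ _ = refl
      compare (suc (suc zero)) (suc (suc zero)) _ _ = refl
      compare zero (suc zero) (_ , p) (_ , q) with () ← partner-unique p q
      compare zero (suc (suc zero)) (p , _) (_ , q) with () ← partner-unique p q
      compare (suc zero) zero (_ , p) (_ , q) with () ← partner-unique p q
      compare (suc zero) (suc (suc zero)) (p , _) (q , _) with () ← partner-unique p q
      compare (suc (suc zero)) zero (_ , p) (q , _) with () ← partner-unique p q
      compare (suc (suc zero)) (suc zero) (p , _) (q , _) with () ← partner-unique p q

  -- The stages and the sets 𝒰_k

  blockAt-just : ∀ p k {b : Fin p} → blockAt p k ≡ just b → toℕ b ≡ k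
  blockAt-just (suc p) zero refl = refl
  blockAt-just (suc p) (suc k) eq with blockAt p k in eq′
  blockAt-just (suc p) (suc k) refl | just _ = cong suc (blockAt-just p k eq′)

  blockAt-toℕ : ∀ p (b : Fin p) → blockAt p (toℕ b) ≡ just b
  blockAt-toℕ (suc p) zero = refl
  blockAt-toℕ (suc p) (suc b) rewrite blockAt-toℕ p b = refl

  record ExtraStep (α β : Mat N) : Set where
    field
      t₀ t₁ : Fin r
      ends : extraEdge r ≡ just (m * 3 ↑ʳ t₀ , m * 3 ↑ʳ t₁)
      adds : AddsEdge α β (extraVtx t₀) (extraVtx t₁)

  extraEdge-view : ∀ s → extraEdge s ≡ nothing
    ⊎ Σ (Fin s) λ t₀ → Σ (Fin s) λ t₁ → t₀ ≢ t₁ × extraEdge s ≡ just (m * 3 ↑ʳ t₀ , m * 3 ↑ʳ t₁)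
  extraEdge-view 0 = inj₁ refl
  extraEdge-view 1 = inj₁ refl
  extraEdge-view 2 = inj₂ (zero , suc zero , (λ ()) , refl)
  extraEdge-view (suc (suc (suc _))) = inj₁ refl

  extraRule-step : ∀ {α β} → ExtraRule α β → ExtraStep α β
  extraRule-step {α} {β} rule with extraEdge-view r
  ... | inj₁ no-edge = ⊥-elim (subst (λ e → ExtraRule′ e α β) no-edge rule)
  ... | inj₂ (t₀ , t₁ , t₀≢t₁ , ends) with subst (λ e → ExtraRule′ e α β) ends rule
  ...   | ¬cov₀ , ¬cov₁ , β≡ = record
    { t₀ = t₀ ; t₁ = t₁ ; ends = ends
    ; adds = record
      { distinct = t₀≢t₁ ∘ extraVtx-injective
      ; uncoveredˡ = ¬Covers⇒≡nothing α ¬cov₀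
      ; uncoveredʳ = ¬Covers⇒≡nothing α ¬cov₁
      ; target = β≡
      }
    }

  data RuleView (k : ℕ) (α β : Mat N) : Set where
    block : ∀ b → toℕ b ≡ k → BlockRule b α β → RuleView k α β
    extra : k ≡ m → ExtraStep α β → RuleView k α β

  ruleView : ∀ {k α β} → Rule k α β → RuleView k α β
  ruleView {k} rule with blockAt m k in eq
  ... | just b = block b (blockAt-just m k eq) rule
  ... | nothing = extra (proj₁ rule) (extraRule-step (proj₂ rule))

  blockRule-rule : ∀ {b α β} → BlockRule b α β → Rule (toℕ b) α β
  blockRule-rule {b} {α} {β} rule = subst (λ mb → Rule′ (toℕ b) mb α β) (sym (blockAt-toℕ m b)) rule

  stage-≤ : ∀ {k α β} → Stage k α β → k ≤ m
  stage-≤ (_ , rule) with ruleView rule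
  ... | block b refl _ = <⇒≤ (toℕ<n b)
  ... | extra refl _ = ≤-refl

  stage-addsEdge : ∀ {k α β} → Stage k α β → ∃ λ x → ∃ λ y → AddsEdge α β x y
  stage-addsEdge (_ , rule) with ruleView rule
  ... | block _ _ blockRule = _ , _ , proj₂ (blockRule-addsEdge blockRule)
  ... | extra _ step = _ , _ , ExtraStep.adds step

  U-antitone : ∀ {j k α} → j ≤ k → U k α → U j α
  U-antitone {k = zero} z≤n u = u
  U-antitone {k = suc k} j≤1+k u with m≤n⇒m<n∨m≡n j≤1+k
  ... | inj₁ j<1+k = U-antitone (≤-pred j<1+k) (proj₁ u)
  ... | inj₂ refl = u

  critical⇒U : ∀ k {α} → k ≤ m → IsMatching α → (∀ b → toℕ b < k → Critical b α) → U k α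
  critical⇒U zero _ α-matching _ = α-matching
  critical⇒U (suc k) 1+k≤m α-matching critical =
    critical⇒U k (<⇒≤ 1+k≤m) α-matching (λ b b<k → critical b (m≤n⇒m≤1+n b<k)) ,
    (λ { (_ , _ , rule) → no-stage rule (proj₁ ∘ critical _) blockRule-source }) ,
    (λ { (_ , _ , rule) → no-stage rule (proj₂ ∘ critical _) blockRule-target })
    where
    no-stage : ∀ {α β} {P : Fin m → Set} → Rule k α β → (∀ {b} → toℕ b < suc k → ¬ P b) →
               (∀ {b} → BlockRule b α β → P b) → ⊥
    no-stage rule ¬P toP with ruleView rule
    ... | block b refl blockRule = ¬P ≤-refl (toP blockRule)
    ... | extra refl _ = <-irrefl refl 1+k≤m

  critical-at-stage : ∀ b {α} → U (toℕ b) α → IsMatching α → (∀ b′ → toℕ b′ < toℕ b → Critical b′ α) →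
                      ¬ (∃ λ β → Stage (toℕ b) α β) → ¬ (∃ λ γ → Stage (toℕ b) γ α) → Critical b α
  critical-at-stage b {α} u α-matching earlier ¬source ¬target = ¬blockSource , ¬blockTarget
    where
    ¬blockSource : ¬ BlockSource b α
    ¬blockSource source = ¬source (_ , u , blockRule-rule (proj₂ (blockSource-rule source)))
    ¬blockTarget : ¬ BlockTarget b α
    ¬blockTarget target with blockTarget-rule α-matching target
    ... | γ , γ-matching , agree , rule = ¬target (γ , critical⇒U (toℕ b) (<⇒≤ (toℕ<n b)) γ-matching
            (λ b′ b′<b → critical-resp (λ i → sym (agree b′ (λ { refl → <-irrefl refl b′<b }) i)) (earlier b′ b′<b)) ,
          blockRule-rule rule)

  U⇒critical : ∀ k {α} → U k α → IsMatching α × (∀ b → toℕ b < k → Critical b α)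
  U⇒critical zero α-matching = α-matching , λ _ ()
  U⇒critical (suc k) {α} (u , ¬source , ¬target) with U⇒critical k u
  ... | α-matching , earlier = α-matching , critical
    where
    critical : ∀ b → toℕ b < suc k → Critical b α
    critical b b<1+k with m≤n⇒m<n∨m≡n (≤-pred b<1+k)
    ... | inj₁ b<k = earlier b b<k
    ... | inj₂ refl = critical-at-stage b u α-matching earlier ¬source ¬target

  addsEdge-agreeOn : ∀ {α β x y} b → AddsEdge α β x y → (∀ i → vtx b i ≢ x) → (∀ i → vtx b i ≢ y) →
                     AgreeOn b α β
  addsEdge-agreeOn b e ≢x ≢y i = sym (addsEdge-lookup-other e (≢x i) (≢y i))

  stage-agreeOn-earlier : ∀ {k α β} → Stage k α β → ∀ b → toℕ b < k → AgreeOn b α β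
  stage-agreeOn-earlier (_ , rule) b b<k with ruleView rule
  ... | block b′ refl blockRule =
    addsEdge-agreeOn b (proj₂ (blockRule-addsEdge blockRule)) (λ _ → vtx-other-block b≢b′) (λ _ → vtx-other-block b≢b′)
    where
    b≢b′ : b ≢ b′
    b≢b′ refl = <-irrefl refl b<k
  stage-agreeOn-earlier (_ , rule) b b<k | extra _ step =
    addsEdge-agreeOn b (ExtraStep.adds step) (λ _ → vtx≢extraVtx) (λ _ → vtx≢extraVtx)

  stage-target-U : ∀ {k α β} → Stage k α β → U k β
  stage-target-U {k} {α} {β} stage with stage-addsEdge stage | U⇒critical k (proj₁ stage)
  ... | _ , _ , e | α-matching , critical = critical⇒U k (stage-≤ stage) (addsEdge-isMatching e α-matching)
    λ b b<k → critical-resp (stage-agreeOn-earlier stage b b<k) (critical b b<k)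

  -- 𝓜 is a discrete vector field

  stage-isPair : ∀ {k α β} → Stage k α β → IsMatching α × IsMatching β × (α ⊊ β) × DimSucc α β
  stage-isPair {k} {α} stage with stage-addsEdge stage
  ... | _ , _ , e = α-matching , addsEdge-isMatching e α-matching , addsEdge-⊊ e , addsEdge-dimSucc e
    where
    α-matching : IsMatching α
    α-matching = proj₁ (U⇒critical k (proj₁ stage))

  stage-leaves-U : ∀ {s α β γ} → Stage s α β → U (suc s) γ → γ ≢ α × γ ≢ β
  stage-leaves-U stage (_ , ¬source , ¬target) =
    (λ { refl → ¬source (_ , stage) }) , (λ { refl → ¬target (_ , stage) })

  later-stage-disjoint : ∀ {s s′ α β α′ β′} → s < s′ → Stage s α β → Stage s′ α′ β′ → ¬ Overlap α β α′ β′
  later-stage-disjoint {α = α} {β} {α′} {β′} s<s′ stage stage′ = λ where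
      (inj₁ α≡α′) → proj₁ α′-leaves (sym α≡α′)
      (inj₂ (inj₁ α≡β′)) → proj₁ β′-leaves (sym α≡β′)
      (inj₂ (inj₂ (inj₁ β≡α′))) → proj₂ α′-leaves (sym β≡α′)
      (inj₂ (inj₂ (inj₂ β≡β′))) → proj₂ β′-leaves (sym β≡β′)
    where
    α′-leaves : α′ ≢ α × α′ ≢ β
    α′-leaves = stage-leaves-U stage (U-antitone s<s′ (proj₁ stage′))
    β′-leaves : β′ ≢ α × β′ ≢ β
    β′-leaves = stage-leaves-U stage (U-antitone s<s′ (stage-target-U stage′))

  blockRule-target-unique : ∀ {b α β β′} → BlockRule b α β → BlockRule b α β′ → β ≡ β′
  blockRule-target-unique {α = α} (inj₁ (i , coversᵢ , β≡)) (inj₁ (i′ , coversᵢ′ , β′≡))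
    with refl ← blockSource-atMostOne {α = α} {j = i} {j′ = i′} (exactly i coversᵢ) (proj₁ coversᵢ) (proj₁ coversᵢ′) =
    trans β≡ (sym β′≡)
  blockRule-target-unique (inj₁ (i , (cov , _) , _)) (inj₂ (¬cov , _)) = ⊥-elim (¬cov i cov)
  blockRule-target-unique (inj₂ (¬cov , _)) (inj₁ (i , (cov , _) , _)) = ⊥-elim (¬cov i cov)
  blockRule-target-unique (inj₂ (_ , β≡)) (inj₂ (_ , β′≡)) = trans β≡ (sym β′≡)

  blockRule-source-unique : ∀ {b α α′ β} → IsMatching β → BlockRule b α β → BlockRule b α′ β → α ≡ α′
  blockRule-source-unique {β = β} β-matching rule rule′ with blockRule-addsEdge rule | blockRule-addsEdge rule′
  ... | i , e | i′ , e′
    with refl ← blockEdge-unique {β = β} {i} {i′} β-matching (addsEdge-lookupˡ e) (addsEdge-lookupˡ e′) =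
    addsEdge-source-unique e e′

  blockRule-overlap : ∀ {b α β α′ β′} → IsMatching α → IsMatching β → BlockRule b α β → BlockRule b α′ β′ →
                      Overlap α β α′ β′ → α ≡ α′ × β ≡ β′
  blockRule-overlap _ _ rule rule′ (inj₁ refl) = refl , blockRule-target-unique rule rule′
  blockRule-overlap α-matching _ rule rule′ (inj₂ (inj₁ refl)) =
    ⊥-elim (blockSource-¬target α-matching (blockRule-source rule) (blockRule-target rule′))
  blockRule-overlap _ β-matching rule rule′ (inj₂ (inj₂ (inj₁ refl))) =
    ⊥-elim (blockSource-¬target β-matching (blockRule-source rule′) (blockRule-target rule))
  blockRule-overlap _ β-matching rule rule′ (inj₂ (inj₂ (inj₂ refl))) =
    blockRule-source-unique β-matching rule rule′ , refl

  extraStep-ends-unique : ∀ {α β α′ β′} (step : ExtraStep α β) (step′ : ExtraStep α′ β′) →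
                          ExtraStep.t₀ step ≡ ExtraStep.t₀ step′ × ExtraStep.t₁ step ≡ ExtraStep.t₁ step′
  extraStep-ends-unique step step′ =
    ↑ʳ-injective (m * 3) _ _ (cong proj₁ ends≡) , ↑ʳ-injective (m * 3) _ _ (cong proj₂ ends≡)
    where ends≡ = Maybe.just-injective (trans (sym (ExtraStep.ends step)) (ExtraStep.ends step′))

  extraStep-overlap : ∀ {α β α′ β′} → ExtraStep α β → ExtraStep α′ β′ → Overlap α β α′ β′ → α ≡ α′ × β ≡ β′
  extraStep-overlap step step′ overlapping with extraStep-ends-unique step step′
  ... | refl , refl = addsEdge-overlap (ExtraStep.adds step) (ExtraStep.adds step′) overlapping

  same-stage-overlap : ∀ {s α β α′ β′} → Stage s α β → Stage s α′ β′ → Overlap α β α′ β′ → α ≡ α′ × β ≡ β′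
  same-stage-overlap stage@(_ , rule) (_ , rule′) overlapping with ruleView rule | ruleView rule′
  ... | block b refl blockRule | block b′ b′≡b blockRule′ with refl ← toℕ-injective b′≡b =
    blockRule-overlap (proj₁ pair) (proj₁ (proj₂ pair)) blockRule blockRule′ overlapping
    where pair = stage-isPair stage
  ... | extra _ step | extra _ step′ = extraStep-overlap step step′ overlapping
  ... | block b refl _ | extra b≡m _ = ⊥-elim (<-irrefl b≡m (toℕ<n b))
  ... | extra refl _ | block b b≡m _ = ⊥-elim (<-irrefl b≡m (toℕ<n b))

  stage-overlap : ∀ {s s′ α β α′ β′} → Stage s α β → Stage s′ α′ β′ → Overlap α β α′ β′ → α ≡ α′ × β ≡ β′
  stage-overlap {s} {s′} stage stage′ overlapping with <-cmp s s′
  ... | tri< s<s′ _ _ = ⊥-elim (later-stage-disjoint s<s′ stage stage′ overlapping)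
  ... | tri≈ _ refl _ = same-stage-overlap stage stage′ overlapping
  ... | tri> _ _ s′<s = ⊥-elim (later-stage-disjoint s′<s stage′ stage (Overlap-sym overlapping))

  isDiscreteVectorField : IsDiscreteVectorField 𝓜
  isDiscreteVectorField = (λ { _ _ (_ , stage) → stage-isPair stage }) ,
                          (λ { _ _ _ _ (_ , stage) (_ , stage′) → stage-overlap stage stage′ })

  -- Acyclicity

  critical-before⇒¬target : ∀ {b k α β} → IsMatching α → (∀ b′ → toℕ b′ < toℕ b → Critical b′ α) →
                            Stage k α β → ¬ BlockTarget b α
  critical-before⇒¬target {b} {k} α-matching critical (u , rule) with <-cmp (toℕ b) k | ruleView rule
  ... | tri< b<k _ _ | _ = proj₂ (proj₂ (U⇒critical k u) b b<k)
  ... | tri≈ _ refl _ | block b′ b′≡b blockRule with refl ← toℕ-injective b′≡b =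
    blockSource-¬target α-matching (blockRule-source blockRule)
  ... | tri≈ _ refl _ | extra b≡m _ = ⊥-elim (<-irrefl b≡m (toℕ<n b))
  ... | tri> _ _ k<b | block b′ refl blockRule = ⊥-elim (proj₁ (critical b′ k<b) (blockRule-source blockRule))
  ... | tri> _ _ k<b | extra refl _ = ⊥-elim (<-irrefl refl (<-trans k<b (toℕ<n b)))

  critical⇒extraStep : ∀ {k α β} → (∀ b → Critical b α) → Stage k α β → ExtraStep α β
  critical⇒extraStep critical (_ , rule) with ruleView rule
  ... | block b _ blockRule = ⊥-elim (proj₁ (critical b) (blockRule-source blockRule))
  ... | extra _ step = step

  -- The weight 3 > 1 + 1 of an outside partner is what makes trade-blockScore-< hold.
  blockWeight : Fin m → Fin N → ℕ
  blockWeight b w = if does (any? λ i → w Fin.≟ vtx b i) then 1 else 3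

  blockWeight-pos : ∀ b w → 0 < blockWeight b w
  blockWeight-pos b w with does (any? λ i → w Fin.≟ vtx b i)
  ... | true = s≤s z≤n
  ... | false = s≤s z≤n

  blockScore : Mat N → Fin m → ℕ
  blockScore α b = weightedSum (blockWeight b) λ i → lookup α (vtx b i)

  extraScore : Mat N → ℕ
  extraScore α = weightedSum (λ _ → 1) λ t → lookup α (extraVtx t)

  potential : Mat N → Vec ℕ m × ℕ
  potential α = tabulate (blockScore α) , extraScore α

  _≺_ : Mat N → Mat N → Set
  α′ ≺ α = potential α′ <ₗₑₓ× potential α

  AgreeOn⇒blockScore≡ : ∀ {b α′ α} → AgreeOn b α′ α → blockScore α′ b ≡ blockScore α b
  AgreeOn⇒blockScore≡ {b} agree = cong sum (tabulate-cong λ i → cong (weigh (blockWeight b)) (agree i))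

  blockScore-mono-< : ∀ {b α′ α} → (∀ i → lookup α′ (vtx b i) ⊑ lookup α (vtx b i)) → ¬ AgreeOn b α′ α →
                      blockScore α′ b < blockScore α b
  blockScore-mono-< {b} = weightedSum-mono-< (blockWeight b) (blockWeight-pos b) Fin._≟_ _ _

  ⊆-blockScore-< : ∀ {b α′ α} → α′ ⊆ α → ¬ AgreeOn b α′ α → blockScore α′ b < blockScore α b
  ⊆-blockScore-< {b} {α′} {α} α′⊆α = blockScore-mono-< {b} {α′} {α} λ i → α′⊆α (vtx b i)

  blockWeight-inside : ∀ b i → blockWeight b (vtx b i) ≡ 1
  blockWeight-inside b i = cong (λ t → if t then 1 else 3) (dec-true (any? λ j → vtx b i Fin.≟ vtx b j) (i , refl))

  blockWeight-outside : ∀ b {w} → (∀ i → w ≢ vtx b i) → blockWeight b w ≡ 3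
  blockWeight-outside b {w} outside =
    cong (λ t → if t then 1 else 3) (dec-false (any? λ i → w Fin.≟ vtx b i) λ (i , w≡vᵢ) → outside i w≡vᵢ)

  module Trade (b : Fin m) where

    weighAt : Mat N → Fin 3 → ℕ
    weighAt γ j = weigh (blockWeight b) (lookup γ (vtx b j))

    unmatched : ∀ {x} → x ≡ nothing → weigh (blockWeight b) x ≡ 0
    unmatched refl = refl

    matchedInside : ∀ {x k} → x ≡ just (vtx b k) → weigh (blockWeight b) x ≡ 1
    matchedInside {k = k} refl = blockWeight-inside b k

    matchedOutside : ∀ {x w} → (∀ k → w ≢ vtx b k) → x ≡ just w → weigh (blockWeight b) x ≡ 3
    matchedOutside outside refl = blockWeight-outside b outside

    by-vertex : ∀ γ {s₀ s₁ s₂} → weighAt γ zero ≡ s₀ → weighAt γ (suc zero) ≡ s₁ → weighAt γ (suc (suc zero)) ≡ s₂ →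
                blockScore γ b ≡ s₀ + (s₁ + (s₂ + 0))
    by-vertex γ e₀ e₁ e₂ = cong₂ _+_ e₀ (cong₂ _+_ e₁ (cong₂ _+_ e₂ refl))

    two<three : ∀ α′ α → blockScore α′ b ≡ 2 → blockScore α b ≡ 3 → blockScore α′ b < blockScore α b
    two<three _ _ α′≡2 α≡3 = subst₂ _<_ (sym α′≡2) (sym α≡3) ≤-refl

  trade-blockScore-< : ∀ {b α α′ w} i → (∀ j → w ≢ vtx b j) →
    lookup α (vtx b i) ≡ just w → lookup α (end₁ b i) ≡ nothing → lookup α (end₂ b i) ≡ nothing →
    lookup α′ (vtx b i) ≡ nothing → lookup α′ (end₁ b i) ≡ just (end₂ b i) → lookup α′ (end₂ b i) ≡ just (end₁ b i) →
    blockScore α′ b < blockScore α b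
  trade-blockScore-< {b} {α} {α′} zero outside αᵢ α₁ α₂ α′ᵢ α′₁ α′₂ =
    two<three α′ α (by-vertex α′ (unmatched α′ᵢ) (matchedInside α′₁) (matchedInside α′₂))
                   (by-vertex α (matchedOutside outside αᵢ) (unmatched α₁) (unmatched α₂))
    where open Trade b
  trade-blockScore-< {b} {α} {α′} (suc zero) outside αᵢ α₁ α₂ α′ᵢ α′₁ α′₂ =
    two<three α′ α (by-vertex α′ (matchedInside α′₁) (unmatched α′ᵢ) (matchedInside α′₂))
                   (by-vertex α (unmatched α₁) (matchedOutside outside αᵢ) (unmatched α₂))
    where open Trade b
  trade-blockScore-< {b} {α} {α′} (suc (suc zero)) outside αᵢ α₁ α₂ α′ᵢ α′₁ α′₂ =
    two<three α′ α (by-vertex α′ (matchedInside α′₁) (matchedInside α′₂) (unmatched α′ᵢ))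
                   (by-vertex α (unmatched α₁) (unmatched α₂) (matchedOutside outside αᵢ))
    where open Trade b

  blockRule-score-< : ∀ {b α β α′} → BlockRule b α β → IsMatching α → IsMatching α′ → α′ ⊆ β →
                      ¬ BlockTarget b α′ → ¬ AgreeOn b α′ α → blockScore α′ b < blockScore α b
  blockRule-score-< {b} {α} {β} {α′} rule@(inj₂ (¬cov , _)) _ α′-matching α′⊆β ¬target ¬agree
    with Maybe.≡-dec Fin._≟_ (lookup α′ (end₁ b zero)) (just (end₂ b zero))
  ... | no ¬edge =
    ⊆-blockScore-< {b} {α′} {α} (addsEdge-⊆-source-without-edge {α′ = α′} α′-matching e α′⊆β ¬edge) ¬agree
    where e = proj₂ (blockRule-addsEdge rule)
  ... | yes edge = ⊥-elim (¬target (alone edge (⊆-¬Covers {α = α′} {β} α′⊆β ¬cov₀)))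
    where
    e : AddsEdge α β (end₁ b zero) (end₂ b zero)
    e = proj₂ (blockRule-addsEdge rule)
    ¬cov₀ : ¬ Covers β (vtx b zero)
    ¬cov₀ = ≡nothing⇒¬Covers β (trans (addsEdge-lookup-other e (vtx≢end₁ zero) (vtx≢end₂ zero))
                                       (¬Covers⇒≡nothing α (¬cov zero)))
  blockRule-score-< {b} {α} {β} {α′} rule@(inj₁ (i , ((w , αᵢ≡w) , ¬cov) , _))
                    α-matching α′-matching α′⊆β ¬target ¬agree
    with Maybe.≡-dec Fin._≟_ (lookup α′ (end₁ b i)) (just (end₂ b i))
  ... | no ¬edge =
    ⊆-blockScore-< {b} {α′} {α} (addsEdge-⊆-source-without-edge {α′ = α′} α′-matching e α′⊆β ¬edge) ¬agree
    where e = proj₂ (blockRule-addsEdge rule)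
  ... | yes edge with lookup α′ (vtx b i) in α′ᵢ
  ...   | just w′ = ⊥-elim (¬target (opposite i edge (w′ , α′ᵢ)))
  ...   | nothing = trade-blockScore-< {b} {α} {α′} i outside αᵢ≡w (AddsEdge.uncoveredˡ e) (AddsEdge.uncoveredʳ e)
                      α′ᵢ edge (proj₂ (α′-matching _ _ edge))
    where
    e : AddsEdge α β (end₁ b i) (end₂ b i)
    e = proj₂ (blockRule-addsEdge rule)
    outside : ∀ j → w ≢ vtx b j
    outside j w≡vⱼ with j Fin.≟ i
    ... | yes refl = proj₁ (α-matching _ w αᵢ≡w) w≡vⱼ
    ... | no j≢i = ¬cov j j≢i (vtx b i , subst (λ u → lookup α u ≡ just (vtx b i)) w≡vⱼ (proj₂ (α-matching _ w αᵢ≡w)))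

  path-step : ∀ {k α β α′} → Stage k α β → ∃ (𝓜 α′) → α′ ⊆ β → α′ ≢ α → α′ ≺ α
  path-step {k} {α} {β} {α′} stage@(u , rule) (β′ , _ , stage′) α′⊆β α′≢α =
    [ all-agree , inj₁ ]′ (pointwise-or-lex (λ b → AgreeOn b α′ α) (blockScore α′) (blockScore α) agree⇒≡ blockStep)
    where
    agree⇒≡ : ∀ b → AgreeOn b α′ α → blockScore α′ b ≡ blockScore α b
    agree⇒≡ b = AgreeOn⇒blockScore≡ {b} {α′} {α}

    α-matching : IsMatching α
    α-matching = proj₁ (U⇒critical k u)
    α-critical : ∀ b → toℕ b < k → Critical b α
    α-critical = proj₂ (U⇒critical k u)
    α′-matching : IsMatching α′
    α′-matching = proj₁ (stage-isPair stage′)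

    critical-where-agreeing : ∀ {b} → AgreeOn b α′ α → toℕ b < k → Critical b α′
    critical-where-agreeing {b} agree b<k = critical-resp {b} {α} {α′} (λ i → sym (agree i)) (α-critical b b<k)

    disagreeing-block : ∀ b → (∀ b′ → b′ Fin.< b → AgreeOn b′ α′ α) → ¬ AgreeOn b α′ α →
                        blockScore α′ b < blockScore α b
    disagreeing-block b earlier ¬agree with ruleView rule
    ... | extra _ step = blockScore-mono-< {b} {α′} {α}
      (λ i → addsEdge-⊑ (ExtraStep.adds step) {α′} α′⊆β vtx≢extraVtx vtx≢extraVtx) ¬agree
    ... | block b₀ refl blockRule with b Fin.≟ b₀
    ...   | yes refl = blockRule-score-< blockRule α-matching α′-matching α′⊆β
      (critical-before⇒¬target α′-matching (λ b′ b′<b → critical-where-agreeing (earlier b′ b′<b) b′<b) stage′) ¬agree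
    ...   | no b≢b₀ = blockScore-mono-< {b} {α′} {α}
      (λ i → addsEdge-⊑ (proj₂ (blockRule-addsEdge blockRule)) {α′} α′⊆β (vtx-other-block b≢b₀) (vtx-other-block b≢b₀))
      ¬agree

    blockStep : ∀ b → (∀ b′ → b′ Fin.< b → AgreeOn b′ α′ α) → AgreeOn b α′ α ⊎ blockScore α′ b < blockScore α b
    blockStep b earlier with all? (λ i → Maybe.≡-dec Fin._≟_ (lookup α′ (vtx b i)) (lookup α (vtx b i)))
    ... | yes agree = inj₁ agree
    ... | no ¬agree = inj₂ (disagreeing-block b earlier ¬agree)

    below-at-extras : (∀ b → AgreeOn b α′ α) → ∀ t → lookup α′ (extraVtx t) ⊑ lookup α (extraVtx t)
    below-at-extras agree t with ruleView rule
    ... | block _ _ blockRule = addsEdge-⊑ (proj₂ (blockRule-addsEdge blockRule)) {α′} α′⊆β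
                                  (vtx≢extraVtx ∘ sym) (vtx≢extraVtx ∘ sym)
    ... | extra refl step
      with critical⇒extraStep (λ b → critical-where-agreeing (agree b) (toℕ<n b)) stage′
    ...   | step′ with extraStep-ends-unique step step′
    ...     | refl , refl = addsEdge-⊆-source {α′ = α′} (ExtraStep.adds step) α′⊆β
                            (AddsEdge.uncoveredˡ (ExtraStep.adds step′)) (AddsEdge.uncoveredʳ (ExtraStep.adds step′))
                            (extraVtx t)

    extraScore-< : (∀ b → AgreeOn b α′ α) → extraScore α′ < extraScore α
    extraScore-< agree =
      weightedSum-mono-< (λ _ → 1) (λ _ → s≤s z≤n) Fin._≟_ _ _ (below-at-extras agree) extras-differ
      where
      extras-differ : ¬ (∀ t → lookup α′ (extraVtx t) ≡ lookup α (extraVtx t))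
      extras-differ same = α′≢α (lookup-ext λ v →
        [ (λ { (b , i , refl) → agree b i }) , (λ { (t , refl) → same t }) ]′ (vertex-cases v))

    all-agree : (∀ b → AgreeOn b α′ α) → α′ ≺ α
    all-agree agree = inj₂ (tabulate-cong (λ b → agree⇒≡ b (agree b)) , extraScore-< agree)

  noClosedPath : ¬ NontrivialClosedPath 𝓜
  noClosedPath (k , a , b , path , closed) =
    <ₗₑₓ×-irrefl (subst (_≺ a 0) closed (descent k ≤-refl))
    where
    next-source : ∀ i → i ≤ k → ∃ (𝓜 (a (suc i)))
    next-source i i≤k with m≤n⇒m<n∨m≡n i≤k
    ... | inj₁ i<k = b (suc i) , proj₁ (path (suc i) i<k)
    ... | inj₂ refl = subst (λ γ → ∃ (𝓜 γ)) (sym closed) (b 0 , proj₁ (path 0 z≤n))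

    step : ∀ i → i ≤ k → a (suc i) ≺ a i
    step i i≤k with path i i≤k
    ... | (_ , stage) , (a⊆b , _) , a≢a = path-step stage (next-source i i≤k) a⊆b a≢a

    descent : ∀ i → i ≤ k → a (suc i) ≺ a 0
    descent zero 0≤k = step 0 0≤k
    descent (suc i) i<k = <ₗₑₓ×-trans (step (suc i) i<k) (descent i (<⇒≤ i<k))

  isGradientVectorField : IsGradientVectorField 𝓜
  isGradientVectorField = isDiscreteVectorField , noClosedPath

mainTheorem2 : (m r : ℕ) → r < 3 → 5 ≤ m * 3 + r →
    (σ : Permutation′ (m * 3 + r)) →
    IsGradientVectorField (Construction.𝓜 m r σ)
mainTheorem2 m r _ _ σ = Gradient.isGradientVectorField m r σ
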